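{- Let $\pi$ be a propositional formula and $\varphi$ an arbitrary formula. Then (1) the formula $\neg\Box\pi\to(\varphi\leftrightarrow[\dagger'\pi]\varphi)$ is valid (true at every world of every Kripke model); but (2) the formula $\neg\Box\pi\to(\varphi\leftrightarrow[\dagger\pi]\varphi)$ is not necessarily valid (there are $\pi$, $\varphi$ for which it fails at some world of some model).
   Context: Atoms come from a countable non-empty set $\mathit{At}$. Formulas are built from $\top$, atoms, $\neg$, $\wedge$, $\Box$, $[\dagger\pi]\varphi$ and $[\dagger'\pi]\varphi$ for propositional $\pi$. A Kripke model $\mathcal M=\langle W,R,V\rangle$ has $W\neq\varnothing$, $R\subseteq W\times W$, $V:\mathit{At}\to\mathcal P(W)$; $\mathcal M,w\models\Box\varphi$ iff $\mathcal M,v\models\varphi$ for all $v$ with $wRv$. A literal is an atom or its negation; a clause is a finite set $D$ of literals read as $\bigvee D$ ($\bigvee\varnothing=\bot$); it is tautological if it contains $p$ and $\neg p$ for some $p$. For propositional $\pi$, $\mathcal C(\pi)$ is the set of non-tautological clauses $D$ with $\models\pi\to\bigvee D$ such that no $D'\subsetneq D$ has $\models\pi\to\bigvee D'$. For a non-tautological clause $D$, $\mathcal M^{\{D\}}_u=\langle W',R',V'\rangle$ has $W'=W\times\{0,1\}$, $(w,i)R'(v,j)$ iff $wRv$, $(w,0)\in V'(p)$ iff $w\in V(p)$, $(w,1)\in V'(p)$ iff $\neg p\in D$, or ($\{p,\neg p\}\cap D=\varnothing$ and $w\in V(p)$). $\mathcal M,w\models[\dagger\pi]\varphi$ iff for all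 $D\in\mathcal C(\pi)$, $\mathcal M^{\{D\}}_u,(w,0)\models\varphi$. Conditional forgetting: $\mathcal M,w\models[\dagger'\pi]\varphi$ iff either $\mathcal M,w\models\Box\pi$ and for all $D\in\mathcal C(\pi)$, $\mathcal M^{\{D\}}_u,(w,0)\models\varphi$; or $\mathcal M,w\not\models\Box\pi$ and $\mathcal M,w\models\varphi$. -}

module Defs where

open import Data.Bool using (Bool; true; false; _∧_; not)
open import Data.List using (List)
open import Data.List.Membership.Propositional using (_∈_)
open import Data.List.Relation.Unary.Any using (Any)
open import Data.List.Relation.Binary.Subset.Propositional using (_⊆_)
open import Data.Product using (Σ; _×_; ∃)
open import Data.Sum using (_⊎_)
open import Data.Unit using (⊤)
open import Relation.Nullary using (¬_)
open import Relation.Binary.PropositionalEquality using (_≡_)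

data PForm (At : Set) : Set where
  ptop  : PForm At
  patom : At → PForm At
  pneg  : PForm At → PForm At
  pand  : PForm At → PForm At → PForm At

data Form (At : Set) : Set where
  top   : Form At
  atom  : At → Form At
  neg   : Form At → Form At
  and   : Form At → Form At → Form At
  box   : Form At → Form At
  dag   : PForm At → Form At → Form At
  dag'  : PForm At → Form At → Form At

ι : ∀ {At} → PForm At → Form At
ι ptop       = top
ι (patom p)  = atom p
ι (pneg π)   = neg (ι π)
ι (pand π ρ) = and (ι π) (ι ρ)

_⇒_ : ∀ {At} → Form At → Form At → Form At
φ ⇒ ψ = neg (and φ (neg ψ))

_⇔_ : ∀ {At} → Form At → Form At → Form At
φ ⇔ ψ = and (φ ⇒ ψ) (ψ ⇒ φ)

data Literal (At : Set) : Set where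
  pos : At → Literal At
  ngt : At → Literal At

-- A clause is a finite set of literals, represented by a list
-- (membership is what matters).
Clause : Set → Set
Clause At = List (Literal At)

Tautological : ∀ {At} → Clause At → Set
Tautological {At} D = Σ At λ p → (pos p ∈ D) × (ngt p ∈ D)

evalP : ∀ {At} → (At → Bool) → PForm At → Bool
evalP v ptop       = true
evalP v (patom p)  = v p
evalP v (pneg π)   = not (evalP v π)
evalP v (pand π ρ) = evalP v π ∧ evalP v ρ

litVal : ∀ {At} → (At → Bool) → Literal At → Bool
litVal v (pos p) = v p
litVal v (ngt p) = not (v p)

Entails : ∀ {At} → PForm At → Clause At → Set
Entails {At} π D = (v : At → Bool) → evalP v π ≡ true → Any (λ l → litVal v l ≡ true) D

_⊊_ : ∀ {At} → Clause At → Clause At → Set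
D' ⊊ D = (D' ⊆ D) × ¬ (D ⊆ D')

InC : ∀ {At} → PForm At → Clause At → Set
InC π D = ¬ Tautological D × Entails π D × (∀ D' → D' ⊊ D → ¬ Entails π D')

record Model (At : Set) : Set₁ where
  field
    W  : Set
    w₀ : W                 -- W ≠ ∅
    R  : W → W → Set
    V  : At → W → Set
open Model public

-- The update 𝓜^{D}_u, with 0 = false and 1 = true.
update : ∀ {At} → Model At → Clause At → Model At
update M D = record
  { W  = W M × Bool
  ; w₀ = (w₀ M Data.Product., false)
  ; R  = λ { (w Data.Product., i) (v Data.Product., j) → R M w v }
  ; V  = λ { p (w Data.Product., false) → V M p w
           ; p (w Data.Product., true)  →
               (ngt p ∈ D) ⊎ ((¬ (pos p ∈ D) × ¬ (ngt p ∈ D)) × V M p w) }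
  }

-- Satisfaction of propositional formulas (agrees clause-by-clause with
-- the satisfaction of their embedding ι π below; given separately only so
-- that the definition of _,_⊨_ is structurally recursive).
_,_⊨ₚ_ : ∀ {At} → (M : Model At) → W M → PForm At → Set
M , w ⊨ₚ ptop      = ⊤
M , w ⊨ₚ patom p   = V M p w
M , w ⊨ₚ pneg π    = ¬ (M , w ⊨ₚ π)
M , w ⊨ₚ pand π ρ  = (M , w ⊨ₚ π) × (M , w ⊨ₚ ρ)

BoxP : ∀ {At} → (M : Model At) → W M → PForm At → Set
BoxP M w π = ∀ v → R M w v → M , v ⊨ₚ π

-- Satisfaction 𝓜 , w ⊨ φ (recursion on φ, for all models at once).
sat : ∀ {At} → Form At → (M : Model At) → W M → Set
sat top        M w = ⊤
sat (atom p)   M w = V M p w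
sat (neg φ)    M w = ¬ (sat φ M w)
sat (and φ ψ)  M w = sat φ M w × sat ψ M w
sat (box φ)    M w = ∀ v → R M w v → sat φ M v
sat (dag π φ)  M w = ∀ D → InC π D → sat φ (update M D) (w Data.Product., false)
sat (dag' π φ) M w =
    (BoxP M w π × (∀ D → InC π D → sat φ (update M D) (w Data.Product., false)))
  ⊎ (¬ BoxP M w π × sat φ M w)

_,_⊨_ : ∀ {At} → (M : Model At) → W M → Form At → Set
M , w ⊨ φ = sat φ M w

Valid : ∀ {At} → Form At → Set₁
Valid {At} φ = (M : Model At) (w : W M) → M , w ⊨ φ

-- Part (1): if □π fails at w, then [†'π]φ is by definition evaluated as φ itself at w.
-- Part (2): [†π] ignores that guard. Take a world w that sees itself (where p holds)
-- and a dead end (where p fails), so ¬□p holds at w, and let φ say that every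
-- ¬p-successor is a dead end. Forgetting p along the clause {p} ∈ 𝒞(p) adds a
-- ¬p-copy of w, which still sees w, so φ fails after the update.
module Submission where

open import Defs
open import Data.Bool using (Bool; true; false)
open import Data.Empty using (⊥-elim)
open import Data.List using ([]; _∷_)
open import Data.List.Membership.Propositional using (find)
open import Data.List.Relation.Unary.Any using (here; there)
open import Data.Nat using (ℕ)
open import Data.Product using (Σ; _×_; _,_)
open import Data.Sum using (inj₁; inj₂)
open import Data.Unit using (tt)
open import Function.Bundles using (_↣_)
open import Relation.Binary.PropositionalEquality using (_≡_; refl)
open import Relation.Nullary using (¬_)

-- sat (φ ⇒ ψ) M w unfolds to ¬ (sat φ M w × ¬ sat ψ M w); sat cannot be inverted by
-- unification, so these are stated on the unfolded propositions.
⇒-intro : {A B : Set} → (A → B) → ¬ (A × ¬ B)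
⇒-intro f (a , ¬b) = ¬b (f a)

⇒-refute : {A B : Set} → A → ¬ B → ¬ ¬ (A × ¬ B)
⇒-refute a ¬b a⇒b = a⇒b (a , ¬b)

⇔-intro : {A B : Set} → (A → B) → (B → A) → ¬ (A × ¬ B) × ¬ (B × ¬ A)
⇔-intro f g = ⇒-intro f , ⇒-intro g

⇔-refute : {A B : Set} → A → ¬ B → ¬ (¬ (A × ¬ B) × ¬ (B × ¬ A))
⇔-refute a ¬b (a⇒b , _) = ⇒-refute a ¬b a⇒b

mutual
  sat-ι⇒⊨ₚ : ∀ {At} (M : Model At) w (π : PForm At) → sat (ι π) M w → M , w ⊨ₚ π
  sat-ι⇒⊨ₚ M w ptop       _       = tt
  sat-ι⇒⊨ₚ M w (patom p)  a       = a
  sat-ι⇒⊨ₚ M w (pneg π)   ¬a a    = ¬a (⊨ₚ⇒sat-ι M w π a)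
  sat-ι⇒⊨ₚ M w (pand π ρ) (a , b) = sat-ι⇒⊨ₚ M w π a , sat-ι⇒⊨ₚ M w ρ b

  ⊨ₚ⇒sat-ι : ∀ {At} (M : Model At) w (π : PForm At) → M , w ⊨ₚ π → sat (ι π) M w
  ⊨ₚ⇒sat-ι M w ptop       _       = tt
  ⊨ₚ⇒sat-ι M w (patom p)  a       = a
  ⊨ₚ⇒sat-ι M w (pneg π)   ¬a a    = ¬a (sat-ι⇒⊨ₚ M w π a)
  ⊨ₚ⇒sat-ι M w (pand π ρ) (a , b) = ⊨ₚ⇒sat-ι M w π a , ⊨ₚ⇒sat-ι M w ρ b

BoxP⇒sat-box-ι : ∀ {At} (M : Model At) w (π : PForm At) →
  BoxP M w π → sat (box (ι π)) M w
BoxP⇒sat-box-ι M w π □π v wRv = ⊨ₚ⇒sat-ι M v π (□π v wRv)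

valid-¬□⇒dag'-trivial : ∀ {At} (π : PForm At) (φ : Form At) →
  Valid (neg (box (ι π)) ⇒ (φ ⇔ dag' π φ))
valid-¬□⇒dag'-trivial π φ M w = ⇒-intro λ ¬□π →
  ⇔-intro (unguarded (¬BoxP ¬□π)) (guarded (¬BoxP ¬□π))
  where
  ¬BoxP : ¬ sat (box (ι π)) M w → ¬ BoxP M w π
  ¬BoxP ¬□π □π = ¬□π (BoxP⇒sat-box-ι M w π □π)

  unguarded : ¬ BoxP M w π → sat φ M w → sat (dag' π φ) M w
  unguarded ¬□π a = inj₂ (¬□π , a)

  guarded : ¬ BoxP M w π → sat (dag' π φ) M w → sat φ M w
  guarded ¬□π (inj₁ (□π , _)) = ⊥-elim (¬□π □π)
  guarded _   (inj₂ (_ , a))  = a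

atom-clause-InC : ∀ {At} (p : At) → InC (patom p) (pos p ∷ [])
atom-clause-InC p = non-tautological , (λ _ → here) , minimal
  where
  non-tautological : ¬ Tautological (pos p ∷ [])
  non-tautological (_ , _ , there ())

  -- Under the all-true valuation D' must contain a literal, which can only be pos p.
  minimal : ∀ D' → D' ⊊ (pos p ∷ []) → ¬ Entails (patom p) D'
  minimal D' (D'⊆[p] , [p]⊈D') entails with find (entails (λ _ → true) refl)
  ... | l , l∈D' , _ with D'⊆[p] l∈D'
  ...   | here refl = [p]⊈D' λ { (here refl) → l∈D' ; (there ()) }

module Counterexample {At : Set} (p : At) where

  M : Model At
  M = record { W = Bool ; w₀ = true ; R = λ w _ → w ≡ true ; V = λ _ w → w ≡ true }

  π : PForm At
  π = patom p

  φ : Form At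
  φ = box (neg (atom p) ⇒ box (neg top))

  D : Clause At
  D = pos p ∷ []

  ¬□π : ¬ sat (box (ι π)) M true
  ¬□π □p with □p false refl
  ... | ()

  φ-holds : sat φ M true
  φ-holds true  _ = ⇒-intro λ ¬p → ⊥-elim (¬p refl)
  φ-holds false _ = ⇒-intro λ _ _ ()

  φ-fails-after-update : ¬ sat φ (update M D) (true , false)
  φ-fails-after-update □φ = ⇒-refute ¬p-in-copy not-dead-end (□φ (true , true) refl)
    where
    ¬p-in-copy : sat (neg (atom p)) (update M D) (true , true)
    ¬p-in-copy (inj₁ (there ()))
    ¬p-in-copy (inj₂ ((p∉D , _) , _)) = p∉D (here refl)

    not-dead-end : ¬ sat (box (neg top)) (update M D) (true , true)
    not-dead-end dead = dead (true , false) refl tt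

  dag-fails : ¬ sat (dag π φ) M true
  dag-fails [†π]φ = φ-fails-after-update ([†π]φ D (atom-clause-InC p))

  refutation : ¬ (M , true ⊨ (neg (box (ι π)) ⇒ (φ ⇔ dag π φ)))
  refutation = ⇒-refute ¬□π (⇔-refute φ-holds dag-fails)

proposition31 : (At : Set) → At → (At ↣ ℕ) →
    ((π : PForm At) (φ : Form At) →
        Valid (neg (box (ι π)) ⇒ (φ ⇔ dag' π φ)))
    × Σ (PForm At) (λ π → Σ (Form At) (λ φ → Σ (Model At) (λ M → Σ (W M) (λ w →
        ¬ (M , w ⊨ (neg (box (ι π)) ⇒ (φ ⇔ dag π φ)))))))
proposition31 _ p _ =
  valid-¬□⇒dag'-trivial , (π , φ , M , true , refutation)
  where open Counterexample p
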